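{- Let $k\geq 2$ and let $G_1,\dots,G_k$ be connected graphs, and let $\overline{G^*}=G_1\boxtimes G_2\boxtimes\cdots\boxtimes G_k$ be their strong product. Then $$rx_3(\overline{G^*})\leq \sum_{i=1}^{k} rx_3(G_i).$$
   Context: In an edge-colored graph (adjacent edges may share colors), a tree is a rainbow tree if no two of its edges have the same color. An edge coloring of $G$ is a $3$-rainbow coloring if for every set $S$ of $3$ vertices there is a rainbow tree in $G$ containing $S$; $rx_3(G)$ is the minimum number of colors in a $3$-rainbow coloring of $G$. The strong product $G\boxtimes H$ has vertex set $V(G)\times V(H)$, with distinct vertices $(g_1,h_1)$, $(g_2,h_2)$ adjacent iff either $g_1=g_2$ and $h_1h_2\in E(H)$, or $h_1=h_2$ and $g_1g_2\in E(G)$, or $g_1g_2\in E(G)$ and $h_1h_2\in E(H)$. -}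

module Defs where

open import Data.Nat using (ℕ; zero; suc; _*_; _+_; _<_; _≤_)
open import Data.Fin using (Fin; remQuot)
open import Data.Fin.Properties using (_≟_)
open import Data.Bool using (Bool; true; false; _∧_; _∨_)
open import Data.Product using (Σ; _×_; _,_; proj₁; proj₂; ∃)
open import Data.List using (List; []; _∷_; map)
open import Data.List.Membership.Propositional using (_∈_; _∉_)
open import Data.List.Relation.Unary.Unique.Propositional using (Unique)
open import Relation.Nullary using (¬_; does)
open import Relation.Binary.PropositionalEquality using (_≡_; refl; trans; sym)

record Graph : Set where
  field
    n      : ℕ
    adj    : Fin n → Fin n → Bool
    adj-sym    : ∀ u v → adj u v ≡ adj v u
    adj-irrefl : ∀ u → adj u u ≡ false
open Graph public

order : Graph → ℕ
order G = n G

Vertex : Graph → Set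
Vertex G = Fin (n G)

Adj : (G : Graph) → Vertex G → Vertex G → Set
Adj G u v = adj G u v ≡ true

data Walk (G : Graph) : Vertex G → Vertex G → Set where
  here : ∀ {u} → Walk G u u
  step : ∀ {u w v} → Adj G u w → Walk G w v → Walk G u v

Connected : Graph → Set
Connected G = ∀ u v → Walk G u v

record EdgeColoring (G : Graph) (m : ℕ) : Set where
  field
    col     : (u v : Vertex G) → Adj G u v → Fin m
    col-sym : ∀ u v (e : Adj G u v) →
              col u v e ≡ col v u (trans (adj-sym G v u) e)
open EdgeColoring public

Edge : Graph → Set
Edge G = Σ (Vertex G) λ u → Σ (Vertex G) λ v → Adj G u v

edgeColor : ∀ {G m} → EdgeColoring G m → Edge G → Fin m
edgeColor c (u , v , e) = col c u v e

data IsTree (G : Graph) : List (Vertex G) → List (Edge G) → Set where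
  single : ∀ v → IsTree G (v ∷ []) []
  attach : ∀ {W E} → IsTree G W E → ∀ u v (e : Adj G u v) →
           u ∈ W → v ∉ W → IsTree G (v ∷ W) ((u , v , e) ∷ E)

Rainbow : ∀ {G m} → EdgeColoring G m → List (Edge G) → Set
Rainbow c E = Unique (map (edgeColor c) E)

Is3Rainbow : ∀ {G m} → EdgeColoring G m → Set
Is3Rainbow {G} c =
  ∀ (x y z : Vertex G) → ¬ x ≡ y → ¬ x ≡ z → ¬ y ≡ z →
  Σ (List (Vertex G)) λ W → Σ (List (Edge G)) λ E →
    IsTree G W E × Rainbow c E × x ∈ W × y ∈ W × z ∈ W

Has3RainbowColoring : Graph → ℕ → Set
Has3RainbowColoring G m = Σ (EdgeColoring G m) Is3Rainbow

Rx3 : Graph → ℕ → Set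
Rx3 G r = Has3RainbowColoring G r × (∀ m → m < r → ¬ Has3RainbowColoring G m)

-- Strong product.  The vertex set Fin (n₁ * n₂) is identified with
-- Fin n₁ × Fin n₂ via the standard bijection remQuot / combine.

private
  eqb : ∀ {k} → Fin k → Fin k → Bool
  eqb a b = does (a ≟ b)

  eqb-sym : ∀ {k} (a b : Fin k) → eqb a b ≡ eqb b a
  eqb-sym a b with a ≟ b | b ≟ a
  ... | Relation.Nullary.yes _ | Relation.Nullary.yes _ = refl
  ... | Relation.Nullary.no _  | Relation.Nullary.no _  = refl
  ... | Relation.Nullary.yes p | Relation.Nullary.no q  = Data.Empty.⊥-elim (q (sym p))
    where import Data.Empty
  ... | Relation.Nullary.no p  | Relation.Nullary.yes q = Data.Empty.⊥-elim (p (sym q))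
    where import Data.Empty

  eqb-refl : ∀ {k} (a : Fin k) → eqb a a ≡ true
  eqb-refl a with a ≟ a
  ... | Relation.Nullary.yes _ = refl
  ... | Relation.Nullary.no q  = Data.Empty.⊥-elim (q refl)
    where import Data.Empty

  sadj : (G H : Graph) → Fin (n G) × Fin (n H) → Fin (n G) × Fin (n H) → Bool
  sadj G H (g₁ , h₁) (g₂ , h₂) =
    (eqb g₁ g₂ ∧ adj H h₁ h₂) ∨ (eqb h₁ h₂ ∧ adj G g₁ g₂) ∨ (adj G g₁ g₂ ∧ adj H h₁ h₂)

  sadj-sym : ∀ G H p q → sadj G H p q ≡ sadj G H q p
  sadj-sym G H (g₁ , h₁) (g₂ , h₂)
    rewrite eqb-sym g₁ g₂ | eqb-sym h₁ h₂ | adj-sym G g₁ g₂ | adj-sym H h₁ h₂ = refl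

  sadj-irrefl : ∀ G H p → sadj G H p p ≡ false
  sadj-irrefl G H (g , h)
    rewrite adj-irrefl G g | adj-irrefl H h | eqb-refl g | eqb-refl h
    = Data.Bool.Properties.∧-zeroʳ false
    where import Data.Bool.Properties

_⊠_ : Graph → Graph → Graph
G ⊠ H = record
  { n = n G * n H
  ; adj = λ x y → sadj G H (remQuot (n H) x) (remQuot (n H) y)
  ; adj-sym = λ x y → sadj-sym G H (remQuot (n H) x) (remQuot (n H) y)
  ; adj-irrefl = λ x → sadj-irrefl G H (remQuot (n H) x)
  }

K₁ : Graph
K₁ = record { n = 1 ; adj = λ _ _ → false ; adj-sym = λ _ _ → refl ; adj-irrefl = λ _ → refl }

⊠ⁿ : (k : ℕ) → (Fin k → Graph) → Graph
⊠ⁿ zero _ = K₁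
⊠ⁿ (suc zero) Gs = Gs Fin.zero
  where import Data.Fin as Fin
⊠ⁿ (suc (suc k)) Gs = Gs Fin.zero ⊠ ⊠ⁿ (suc k) (λ i → Gs (Fin.suc i))
  where import Data.Fin as Fin

∑ : (k : ℕ) → (Fin k → ℕ) → ℕ
∑ zero f = 0
∑ (suc k) f = f Fin.zero + ∑ k (λ i → f (Fin.suc i))
  where import Data.Fin as Fin

module Submission where

-- Given 3-rainbow colourings of G and H with a and b colours, colour an edge
-- of G ⊠ H by its G-colour when its first coordinates are adjacent, and otherwise by its
-- H-colour shifted past the a colours of G.  For three vertices (gᵢ, hᵢ) take rainbow trees
-- T_G ∋ g₁, g₂, g₃ and T_H ∋ h₁, h₂, h₃.  In a tree, three vertices are reached from one
-- centre o by three arms (subtrees) pairwise meeting only at o; being inside a rainbow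
-- tree, the arms also have pairwise disjoint colours (tripod lemma).  The copy of T_H in
-- the column of o, together with the copy of the i-th arm in the row of hᵢ, is a rainbow
-- tree through the three vertices: the row copies are glued on one at a time, each meeting
-- the tree built so far only in (o, hᵢ) and bringing only new colours.

open import Defs
open import Data.Nat using (ℕ; _≤_; suc; _+_; s≤s; z≤n)
open import Data.Nat.Properties using (≮⇒≥; +-identityʳ; *-mono-≤; ≤-trans)
open import Data.Fin using (Fin; zero; suc; combine; remQuot; _↑ˡ_; _↑ʳ_; splitAt)
open import Data.Fin.Properties using (remQuot-combine; combine-remQuot; combine-injectiveˡ; combine-injectiveʳ; ↑ˡ-injective; ↑ʳ-injective; splitAt-↑ˡ; splitAt-↑ʳ; _≟_)
open import Data.Bool using (Bool; true; false; _∧_; _∨_)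
import Data.Bool.Properties as Bool
open import Data.Product using (Σ; _×_; _,_; proj₁; proj₂; ∃)
open import Data.Sum using (_⊎_; inj₁; inj₂; [_,_])
import Data.Sum as Sum
open import Data.Empty using (⊥; ⊥-elim)
open import Function using (_∘_; id)
open import Data.List using (List; []; _∷_; map; _++_)
open import Data.List.Relation.Unary.Any using (Any; here; there)
open import Data.List.Relation.Unary.All using (All; []; _∷_; lookupWith)
import Data.List.Relation.Unary.All as All
open import Data.List.Relation.Unary.All.Properties.Core using (¬Any⇒All¬)
open import Data.List.Relation.Unary.AllPairs using ([]; _∷_)
open import Data.List.Membership.Propositional using (_∈_; _∉_)
open import Data.List.Membership.Propositional.Properties using (∈-map⁺; ∈-map⁻; ∈-++⁺ˡ; ∈-++⁺ʳ; ∈-++⁻)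
open import Data.List.Relation.Binary.Subset.Propositional using (_⊆_)
open import Data.List.Relation.Binary.Subset.Propositional.Properties using (xs⊆xs++ys; ++⁺ʳ)
open import Data.List.Relation.Binary.Disjoint.Propositional using (Disjoint)
open import Data.List.Relation.Unary.Unique.Propositional using (Unique; tail)
open import Data.List.Relation.Unary.Unique.Propositional.Properties using (map⁺; Unique[x∷xs]⇒x∉xs)
open import Relation.Nullary using (yes; no; does)
open import Relation.Nullary.Decidable using (dec-true)
open import Relation.Binary.PropositionalEquality using (_≡_; _≢_; refl; sym; trans; cong; cong₂; subst; subst₂)
open import Axiom.UniquenessOfIdentityProofs using (module Decidable⇒UIP)

adj-irrelevant : {x y : Bool} (p q : x ≡ y) → p ≡ q
adj-irrelevant = Decidable⇒UIP.≡-irrelevant Bool._≟_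

unique-∷ : ∀ {A : Set} {x : A} {xs} → x ∉ xs → Unique xs → Unique (x ∷ xs)
unique-∷ {xs = xs} x∉xs u = ¬Any⇒All¬ xs x∉xs ∷ u

↑ˡ≢↑ʳ : ∀ {a b} (i : Fin a) (j : Fin b) → i ↑ˡ b ≢ a ↑ʳ j
↑ˡ≢↑ʳ {a} {b} i j eq
  with () ← trans (sym (splitAt-↑ˡ a i b)) (trans (cong (splitAt a) eq) (splitAt-↑ʳ a b j))

reverse : (K : Graph) {u v : Vertex K} → Adj K u v → Adj K v u
reverse K {u} {v} e = trans (adj-sym K v u) e

module _ {K : Graph} {m : ℕ} (c : EdgeColoring K m) where

  colours : List (Edge K) → List (Fin m)
  colours = map (edgeColor c)

  colour-cong : ∀ {u u' v v'} → u ≡ u' → v ≡ v' → (e : Adj K u v) (e' : Adj K u' v') →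
                col c u v e ≡ col c u' v' e'
  colour-cong refl refl e e' = cong (col c _ _) (adj-irrelevant e e')

record RainbowTree {K : Graph} {m : ℕ} (c : EdgeColoring K m) : Set where
  field
    verts   : List (Vertex K)
    edges   : List (Edge K)
    isTree  : IsTree K verts edges
    rainbow : Rainbow c edges
open RainbowTree public

module _ {K : Graph} {m : ℕ} {c : EdgeColoring K m} where

  grow : (T : RainbowTree c) {u v : Vertex K} → u ∈ verts T → v ∉ verts T →
         (e : Adj K u v) → col c u v e ∉ colours c (edges T) → RainbowTree c
  grow T {u} {v} u∈T v∉T e fresh = record
    { verts = v ∷ verts T ; edges = (u , v , e) ∷ edges T
    ; isTree = attach (isTree T) u v e u∈T v∉T ; rainbow = unique-∷ fresh (rainbow T) }

  record Glued (T : RainbowTree c) (W : List (Vertex K)) (E : List (Edge K)) : Set where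
    field
      union       : RainbowTree c
      ⊇left       : verts T ⊆ verts union
      ⊇right      : W ⊆ verts union
      vertsUnion  : verts union ⊆ verts T ++ W
      coloursUnion : colours c (edges union) ⊆ colours c (edges T) ++ colours c E
  open Glued public

  -- Induction on the second tree; when x is its last-attached vertex v, the tree is
  -- re-rooted by moving the edge uv to the first tree and continuing from u.
  glue : (T : RainbowTree c) {W : List (Vertex K)} {E : List (Edge K)} {x : Vertex K} →
         IsTree K W E → Rainbow c E → x ∈ verts T → x ∈ W →
         (∀ {w} → w ∈ W → w ∈ verts T → w ≡ x) →
         Disjoint (colours c (edges T)) (colours c E) → Glued T W E
  glue T (single _) _ x∈T (here refl) _ _ = record
    { union = T ; ⊇left = id ; ⊇right = λ { (here refl) → x∈T }
    ; vertsUnion = xs⊆xs++ys _ _ ; coloursUnion = xs⊆xs++ys _ _ }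
  glue T {v ∷ W} {(u , v , e) ∷ E} (attach t u v e u∈W v∉W) rb x∈T (there x∈W) meet disj = record
    { union = grow (union U) (⊇right U u∈W) v∉U e fresh
    ; ⊇left = there ∘ ⊇left U
    ; ⊇right = λ { (here refl) → here refl ; (there w∈W) → there (⊇right U w∈W) }
    ; vertsUnion = λ { (here refl) → ∈-++⁺ʳ (verts T) (here refl)
                     ; (there p∈U) → ++⁺ʳ (verts T) there (vertsUnion U p∈U) }
    ; coloursUnion = λ { (here refl) → ∈-++⁺ʳ (colours c (edges T)) (here refl)
                       ; (there k∈U) → ++⁺ʳ (colours c (edges T)) there (coloursUnion U k∈U) } }
    where
    U : Glued T W E
    U = glue T t (tail rb) x∈T x∈W (meet ∘ there) (λ (k∈T , k∈E) → disj (k∈T , there k∈E))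
    v∉U : v ∉ verts (union U)
    v∉U v∈U with ∈-++⁻ (verts T) (vertsUnion U v∈U)
    ... | inj₁ v∈T = v∉W (subst (_∈ W) (sym (meet (here refl) v∈T)) x∈W)
    ... | inj₂ v∈W = v∉W v∈W
    fresh : col c u v e ∉ colours c (edges (union U))
    fresh k∈U with ∈-++⁻ (colours c (edges T)) (coloursUnion U k∈U)
    ... | inj₁ k∈T = disj (k∈T , here refl)
    ... | inj₂ k∈E = Unique[x∷xs]⇒x∉xs rb k∈E
  glue T {v ∷ W} {(u , v , e) ∷ E} (attach t u v e u∈W v∉W) rb v∈T (here refl) meet disj = record
    { union = union U
    ; ⊇left = ⊇left U ∘ there
    ; ⊇right = λ { (here refl) → ⊇left U (there v∈T) ; (there w∈W) → ⊇right U w∈W }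
    ; vertsUnion = λ p∈U → case-verts (∈-++⁻ (u ∷ verts T) (vertsUnion U p∈U))
    ; coloursUnion = λ k∈U → case-colours (∈-++⁻ (_ ∷ colours c (edges T)) (coloursUnion U k∈U)) }
    where
    same-colour : col c v u (reverse K e) ≡ col c u v e
    same-colour = sym (col-sym c u v e)
    u∉T : u ∉ verts T
    u∉T u∈T = v∉W (subst (_∈ W) (meet (there u∈W) u∈T) u∈W)
    fresh : col c v u (reverse K e) ∉ colours c (edges T)
    fresh k∈T = disj (subst (_∈ colours c (edges T)) same-colour k∈T , here refl)
    T₁ : RainbowTree c
    T₁ = grow T v∈T u∉T (reverse K e) fresh
    meet₁ : ∀ {w} → w ∈ W → w ∈ verts T₁ → w ≡ u
    meet₁ w∈W (here w≡u) = w≡u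
    meet₁ w∈W (there w∈T) = ⊥-elim (v∉W (subst (_∈ W) (meet (there w∈W) w∈T) w∈W))
    disj₁ : Disjoint (colours c (edges T₁)) (colours c E)
    disj₁ (here refl , k∈E) = Unique[x∷xs]⇒x∉xs rb (subst (_∈ colours c E) same-colour k∈E)
    disj₁ (there k∈T , k∈E) = disj (k∈T , there k∈E)
    U : Glued T₁ W E
    U = glue T₁ t (tail rb) (here refl) u∈W meet₁ disj₁
    case-verts : ∀ {p} → p ∈ u ∷ verts T ⊎ p ∈ W → p ∈ verts T ++ v ∷ W
    case-verts (inj₁ (here refl)) = ∈-++⁺ʳ (verts T) (there u∈W)
    case-verts (inj₁ (there p∈T)) = ∈-++⁺ˡ p∈T
    case-verts (inj₂ p∈W) = ∈-++⁺ʳ (verts T) (there p∈W)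
    case-colours : ∀ {k} → k ∈ col c v u (reverse K e) ∷ colours c (edges T) ⊎ k ∈ colours c E →
                   k ∈ colours c (edges T) ++ colours c ((u , v , e) ∷ E)
    case-colours (inj₁ (here refl)) = ∈-++⁺ʳ (colours c (edges T)) (here same-colour)
    case-colours (inj₁ (there k∈T)) = ∈-++⁺ˡ k∈T
    case-colours (inj₂ k∈E) = ∈-++⁺ʳ (colours c (edges T)) (there k∈E)

record ColourEmbedding {K K' : Graph} {m m' : ℕ}
                       (c : EdgeColoring K m) (c' : EdgeColoring K' m') : Set where
  field
    vmap           : Vertex K → Vertex K'
    vmap-injective : ∀ {u v} → vmap u ≡ vmap v → u ≡ v
    adj-preserved  : ∀ {u v} → Adj K u v → Adj K' (vmap u) (vmap v)
    cmap           : Fin m → Fin m'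
    cmap-injective : ∀ {i j} → cmap i ≡ cmap j → i ≡ j
    col-preserved  : ∀ {u v} (e : Adj K u v) (e' : Adj K' (vmap u) (vmap v)) →
                     col c' (vmap u) (vmap v) e' ≡ cmap (col c u v e)

module _ {K K' : Graph} {m m' : ℕ} {c : EdgeColoring K m} {c' : EdgeColoring K' m'}
         (φ : ColourEmbedding c c') where
  open ColourEmbedding φ

  private
    edge-image : Edge K → Edge K'
    edge-image (u , v , e) = vmap u , vmap v , adj-preserved e

    tree-image : ∀ {W E} → IsTree K W E → IsTree K' (map vmap W) (map edge-image E)
    tree-image (single v) = single (vmap v)
    tree-image (attach t u v e u∈W v∉W) =
      attach (tree-image t) (vmap u) (vmap v) (adj-preserved e) (∈-map⁺ vmap u∈W) v∉image
      where
      v∉image : vmap v ∉ map vmap _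
      v∉image v∈ with ∈-map⁻ vmap v∈
      ... | w , w∈W , eq = v∉W (subst (_∈ _) (sym (vmap-injective eq)) w∈W)

    colours-image : ∀ E → colours c' (map edge-image E) ≡ map cmap (colours c E)
    colours-image [] = refl
    colours-image ((u , v , e) ∷ E) = cong₂ _∷_ (col-preserved e (adj-preserved e)) (colours-image E)

  image : RainbowTree c → RainbowTree c'
  image T = record
    { verts = map vmap (verts T) ; edges = map edge-image (edges T)
    ; isTree = tree-image (isTree T)
    ; rainbow = subst Unique (sym (colours-image (edges T))) (map⁺ cmap-injective (rainbow T)) }

  image-colours : (T : RainbowTree c) → colours c' (edges (image T)) ≡ map cmap (colours c (edges T))
  image-colours T = colours-image (edges T)

module _ {K : Graph} {m : ℕ} {c : EdgeColoring K m} where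

  record Separated (x : Vertex K) (A B : RainbowTree c) : Set where
    constructor separated
    field
      meet-only : ∀ {w} → w ∈ verts A → w ∈ verts B → w ≡ x
      no-common-colour : Disjoint (colours c (edges A)) (colours c (edges B))

  separated-sym : ∀ {x A B} → Separated x A B → Separated x B A
  separated-sym (separated meet disj) =
    separated (λ w∈B w∈A → meet w∈A w∈B) (λ (k∈B , k∈A) → disj (k∈A , k∈B))

  record Arm (W : List (Vertex K)) (E : List (Edge K)) (centre target : Vertex K) : Set where
    field
      arm         : RainbowTree c
      centre∈arm  : centre ∈ verts arm
      target∈arm  : target ∈ verts arm
      arm⊆host    : verts arm ⊆ W
      colours⊆host : colours c (edges arm) ⊆ colours c E
  open Arm public

  record Tripod (W : List (Vertex K)) (E : List (Edge K)) (x y z : Vertex K) : Set where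
    field
      centre : Vertex K
      arm₁   : Arm W E centre x
      arm₂   : Arm W E centre y
      arm₃   : Arm W E centre z
      sep₁₂  : Separated centre (arm arm₁) (arm arm₂)
      sep₁₃  : Separated centre (arm arm₁) (arm arm₃)
      sep₂₃  : Separated centre (arm arm₂) (arm arm₃)
  open Tripod public

  swap₁₂ : ∀ {W E x y z} → Tripod W E x y z → Tripod W E y x z
  swap₁₂ P = record { centre = centre P ; arm₁ = arm₂ P ; arm₂ = arm₁ P ; arm₃ = arm₃ P
                    ; sep₁₂ = separated-sym (sep₁₂ P) ; sep₁₃ = sep₂₃ P ; sep₂₃ = sep₁₃ P }

  swap₁₃ : ∀ {W E x y z} → Tripod W E x y z → Tripod W E z y x
  swap₁₃ P = record { centre = centre P ; arm₁ = arm₃ P ; arm₂ = arm₂ P ; arm₃ = arm₁ P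
                    ; sep₁₂ = separated-sym (sep₂₃ P) ; sep₁₃ = separated-sym (sep₁₃ P)
                    ; sep₂₃ = separated-sym (sep₁₂ P) }

  point : Vertex K → RainbowTree c
  point v = record { verts = v ∷ [] ; edges = [] ; isTree = single v ; rainbow = [] }

  point-separated : ∀ {v} (A : RainbowTree c) → Separated v (point v) A
  point-separated _ = separated (λ { (here refl) _ → refl }) (λ ())

  point-arm : ∀ {W E v} → v ∈ W → Arm W E v v
  point-arm {v = v} v∈W = record
    { arm = point v
    ; centre∈arm = here refl ; target∈arm = here refl
    ; arm⊆host = λ { (here refl) → v∈W } ; colours⊆host = λ () }

  whole-arm : ∀ {W E v z} → IsTree K W E → Rainbow c E → v ∈ W → z ∈ W → Arm W E v z
  whole-arm t rb v∈W z∈W = record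
    { arm = record { verts = _ ; edges = _ ; isTree = t ; rainbow = rb }
    ; centre∈arm = v∈W ; target∈arm = z∈W ; arm⊆host = id ; colours⊆host = id }

  centred : ∀ {W E v z} → IsTree K W E → Rainbow c E → v ∈ W → z ∈ W → Tripod W E v v z
  centred t rb v∈W z∈W = record
    { centre = _ ; arm₁ = point-arm v∈W ; arm₂ = point-arm v∈W ; arm₃ = whole-arm t rb v∈W z∈W
    ; sep₁₂ = point-separated _ ; sep₁₃ = point-separated _ ; sep₂₃ = point-separated _ }

  -- The host (v ∷ W, uv ∷ E) below is the rainbow tree (W, E) with a new leaf v attached at u.
  module _ {W E u v} {e : Adj K u v} (v∉W : v ∉ W) (rb : Rainbow c ((u , v , e) ∷ E)) where

    weaken-arm : ∀ {x y} → Arm W E x y → Arm (v ∷ W) ((u , v , e) ∷ E) x y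
    weaken-arm A = record
      { arm = arm A ; centre∈arm = centre∈arm A ; target∈arm = target∈arm A
      ; arm⊆host = there ∘ arm⊆host A ; colours⊆host = there ∘ colours⊆host A }

    weaken : ∀ {x y z} → Tripod W E x y z → Tripod (v ∷ W) ((u , v , e) ∷ E) x y z
    weaken P = record
      { centre = centre P ; arm₁ = weaken-arm (arm₁ P) ; arm₂ = weaken-arm (arm₂ P)
      ; arm₃ = weaken-arm (arm₃ P) ; sep₁₂ = sep₁₂ P ; sep₁₃ = sep₁₃ P ; sep₂₃ = sep₂₃ P }

    private
      v∉arm : ∀ {x y} (A : Arm W E x y) → v ∉ verts (arm A)
      v∉arm A = v∉W ∘ arm⊆host A

      new-colour∉arm : ∀ {x y} (A : Arm W E x y) → col c u v e ∉ colours c (edges (arm A))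
      new-colour∉arm A = Unique[x∷xs]⇒x∉xs rb ∘ colours⊆host A

    extend-arm : ∀ {x} → Arm W E x u → Arm (v ∷ W) ((u , v , e) ∷ E) x v
    extend-arm A = record
      { arm = grow (arm A) (target∈arm A) (v∉arm A) e (new-colour∉arm A)
      ; centre∈arm = there (centre∈arm A) ; target∈arm = here refl
      ; arm⊆host = λ { (here refl) → here refl ; (there w∈A) → there (arm⊆host A w∈A) }
      ; colours⊆host = λ { (here refl) → here refl ; (there k∈A) → there (colours⊆host A k∈A) } }

    extend-separated : ∀ {x y} (A : Arm W E x u) (B : Arm W E x y) →
                       Separated x (arm A) (arm B) → Separated x (arm (extend-arm A)) (arm B)
    extend-separated {x} A B (separated meet disj) = separated meet′ disj′
      where
      meet′ : ∀ {w} → w ∈ verts (arm (extend-arm A)) → w ∈ verts (arm B) → w ≡ x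
      meet′ (here refl) v∈B = ⊥-elim (v∉arm B v∈B)
      meet′ (there w∈A) w∈B = meet w∈A w∈B
      disj′ : Disjoint (colours c (edges (arm (extend-arm A)))) (colours c (edges (arm B)))
      disj′ (here refl , k∈B) = new-colour∉arm B k∈B
      disj′ (there k∈A , k∈B) = disj (k∈A , k∈B)

    via-leaf : ∀ {y z} → Tripod W E u y z → Tripod (v ∷ W) ((u , v , e) ∷ E) v y z
    via-leaf P = record
      { centre = centre P ; arm₁ = extend-arm (arm₁ P)
      ; arm₂ = weaken-arm (arm₂ P) ; arm₃ = weaken-arm (arm₃ P)
      ; sep₁₂ = extend-separated (arm₁ P) (arm₂ P) (sep₁₂ P)
      ; sep₁₃ = extend-separated (arm₁ P) (arm₃ P) (sep₁₃ P) ; sep₂₃ = sep₂₃ P }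

  tripod : ∀ {W E x y z} → IsTree K W E → Rainbow c E → x ∈ W → y ∈ W → z ∈ W → Tripod W E x y z
  tripod t@(single _) rb (here refl) (here refl) z∈ = centred t rb (here refl) z∈
  tripod (attach t u v e u∈W v∉W) rb (there x∈) (there y∈) (there z∈) =
    weaken v∉W rb (tripod t (tail rb) x∈ y∈ z∈)
  tripod (attach t u v e u∈W v∉W) rb (here refl) (there y∈) (there z∈) =
    via-leaf v∉W rb (tripod t (tail rb) u∈W y∈ z∈)
  tripod (attach t u v e u∈W v∉W) rb (there x∈) (here refl) (there z∈) =
    swap₁₂ (via-leaf v∉W rb (tripod t (tail rb) u∈W x∈ z∈))
  tripod (attach t u v e u∈W v∉W) rb (there x∈) (there y∈) (here refl) =
    swap₁₃ (via-leaf v∉W rb (tripod t (tail rb) u∈W y∈ x∈))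
  tripod t@(attach _ _ _ _ _ _) rb (here refl) (here refl) z∈ = centred t rb (here refl) z∈
  tripod t@(attach _ _ _ _ _ _) rb (here refl) (there y∈) (here refl) =
    swap₁₂ (swap₁₃ (centred t rb (here refl) (there y∈)))
  tripod t@(attach _ _ _ _ _ _) rb (there x∈) (here refl) (here refl) =
    swap₁₃ (centred t rb (here refl) (there x∈))

avoid : ∀ {k} → 3 ≤ k → (p q : Fin k) → Σ (Fin k) λ t → t ≢ p × t ≢ q
avoid (s≤s (s≤s (s≤s _))) zero zero = suc zero , (λ ()) , (λ ())
avoid (s≤s (s≤s (s≤s _))) zero (suc zero) = suc (suc zero) , (λ ()) , (λ ())
avoid (s≤s (s≤s (s≤s _))) zero (suc (suc _)) = suc zero , (λ ()) , (λ ())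
avoid (s≤s (s≤s (s≤s _))) (suc zero) zero = suc (suc zero) , (λ ()) , (λ ())
avoid (s≤s (s≤s (s≤s _))) (suc (suc _)) zero = suc zero , (λ ()) , (λ ())
avoid (s≤s (s≤s (s≤s _))) (suc _) (suc _) = zero , (λ ()) , (λ ())

module _ {K : Graph} {m : ℕ} {c : EdgeColoring K m} (big : 3 ≤ order K) (rb₃ : Is3Rainbow c) where

  private
    tree-of : ∀ {x y z} → (∃ λ W → ∃ λ E → IsTree K W E × Rainbow c E × x ∈ W × y ∈ W × z ∈ W) →
              Σ (RainbowTree c) λ T → x ∈ verts T × y ∈ verts T × z ∈ verts T
    tree-of (W , E , t , rb , x∈ , y∈ , z∈) =
      record { verts = W ; edges = E ; isTree = t ; rainbow = rb } , x∈ , y∈ , z∈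

    -- Any two vertices lie in a rainbow tree: complete them to three distinct vertices.
    cover₂ : ∀ x z → Σ (RainbowTree c) λ T → x ∈ verts T × z ∈ verts T
    cover₂ x z with x ≟ z
    ... | yes refl =
      let t₁ , t₁≢x , _ = avoid big x x
          t₂ , t₂≢x , t₂≢t₁ = avoid big x t₁
          T , x∈ , _ = tree-of (rb₃ x t₁ t₂ (t₁≢x ∘ sym) (t₂≢x ∘ sym) (t₂≢t₁ ∘ sym))
      in T , x∈ , x∈
    ... | no x≢z =
      let t , t≢x , t≢z = avoid big x z
          T , x∈ , z∈ , _ = tree-of (rb₃ x z t x≢z (t≢x ∘ sym) (t≢z ∘ sym))
      in T , x∈ , z∈

  rainbow-cover : ∀ x y z → Σ (RainbowTree c) λ T → x ∈ verts T × y ∈ verts T × z ∈ verts T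
  rainbow-cover x y z with x ≟ y | x ≟ z | y ≟ z
  ... | yes refl | _ | _ = let T , x∈ , z∈ = cover₂ x z in T , x∈ , x∈ , z∈
  ... | no _ | yes refl | _ = let T , x∈ , y∈ = cover₂ x y in T , x∈ , y∈ , x∈
  ... | no _ | no _ | yes refl = let T , x∈ , y∈ = cover₂ x y in T , x∈ , y∈ , y∈
  ... | no x≢y | no x≢z | no y≢z = tree-of (rb₃ x y z x≢y x≢z y≢z)

module Product (G H : Graph) {a b : ℕ} (cG : EdgeColoring G a) (cH : EdgeColoring H b) where

  P : Graph
  P = G ⊠ H

  vertex : Vertex G → Vertex H → Vertex P
  vertex = combine

  π₁ : Vertex P → Vertex G
  π₁ p = proj₁ (remQuot {n G} (n H) p)

  π₂ : Vertex P → Vertex H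
  π₂ p = proj₂ (remQuot {n G} (n H) p)

  π₁-vertex : ∀ g h → π₁ (vertex g h) ≡ g
  π₁-vertex g h = cong proj₁ (remQuot-combine g h)

  π₂-vertex : ∀ g h → π₂ (vertex g h) ≡ h
  π₂-vertex g h = cong proj₂ (remQuot-combine g h)

  -- The adjacency of G ⊠ H on coordinate pairs; adj (G ⊠ H) p q unfolds to it definitionally.
  coordAdj : Vertex G × Vertex H → Vertex G × Vertex H → Bool
  coordAdj (g₁ , h₁) (g₂ , h₂) =
    (does (g₁ ≟ g₂) ∧ adj H h₁ h₂) ∨ (does (h₁ ≟ h₂) ∧ adj G g₁ g₂) ∨ (adj G g₁ g₂ ∧ adj H h₁ h₂)

  row-adj : ∀ {g g' h} → Adj G g g' → Adj P (vertex g h) (vertex g' h)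
  row-adj {g} {g'} {h} e = trans (cong₂ coordAdj (remQuot-combine g h) (remQuot-combine g' h)) in-row
    where
    in-row : coordAdj (g , h) (g' , h) ≡ true
    in-row rewrite dec-true (h ≟ h) refl | e = Bool.∨-zeroʳ _

  column-adj : ∀ {g h h'} → Adj H h h' → Adj P (vertex g h) (vertex g h')
  column-adj {g} {h} {h'} e =
    trans (cong₂ coordAdj (remQuot-combine g h) (remQuot-combine g h')) in-column
    where
    in-column : coordAdj (g , h) (g , h') ≡ true
    in-column rewrite dec-true (g ≟ g) refl | e = refl

  no-coordAdj : ∀ x y → adj G (proj₁ x) (proj₁ y) ≡ false → adj H (proj₂ x) (proj₂ y) ≡ false →
                coordAdj x y ≡ false
  no-coordAdj (g₁ , h₁) (g₂ , h₂) nG nH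
    rewrite nG | nH | Bool.∧-zeroʳ (does (g₁ ≟ g₂)) | Bool.∧-zeroʳ (does (h₁ ≟ h₂)) = refl

  second-adj : ∀ {p q} → Adj P p q → adj G (π₁ p) (π₁ q) ≡ false → Adj H (π₂ p) (π₂ q)
  second-adj {p} {q} e nG with adj H (π₂ p) (π₂ q) Bool.≟ true
  ... | yes eH = eH
  ... | no ¬eH
    with () ← trans (sym (no-coordAdj (remQuot {n G} (n H) p) (remQuot {n G} (n H) q) nG (Bool.¬-not ¬eH))) e

  productCol : (p q : Vertex P) → Adj P p q → Fin (a + b)
  productCol p q e with adj G (π₁ p) (π₁ q) Bool.≟ true
  ... | yes eG = col cG _ _ eG ↑ˡ b
  ... | no ¬eG = a ↑ʳ col cH _ _ (second-adj e (Bool.¬-not ¬eG))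

  productCol-sym : ∀ p q (e : Adj P p q) → productCol p q e ≡ productCol q p (reverse P e)
  productCol-sym p q e with adj G (π₁ p) (π₁ q) Bool.≟ true | adj G (π₁ q) (π₁ p) Bool.≟ true
  ... | yes eG | yes eG' = cong (_↑ˡ b) (trans (col-sym cG _ _ eG) (colour-cong cG refl refl _ eG'))
  ... | no _   | no _    = cong (a ↑ʳ_) (trans (col-sym cH _ _ _) (colour-cong cH refl refl _ _))
  ... | yes eG | no ¬eG' = ⊥-elim (¬eG' (reverse G eG))
  ... | no ¬eG | yes eG' = ⊥-elim (¬eG (reverse G eG'))

  productColouring : EdgeColoring P (a + b)
  productColouring = record { col = productCol ; col-sym = productCol-sym }

  row-colour : ∀ {g g' h} (eG : Adj G g g') (e : Adj P (vertex g h) (vertex g' h)) →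
               productCol _ _ e ≡ col cG g g' eG ↑ˡ b
  row-colour {g} {g'} {h} eG e with adj G (π₁ (vertex g h)) (π₁ (vertex g' h)) Bool.≟ true
  ... | yes eG' = cong (_↑ˡ b) (colour-cong cG (π₁-vertex g h) (π₁-vertex g' h) eG' eG)
  ... | no ¬eG' = ⊥-elim (¬eG' (subst₂ (Adj G) (sym (π₁-vertex g h)) (sym (π₁-vertex g' h)) eG))

  column-colour : ∀ {g h h'} (eH : Adj H h h') (e : Adj P (vertex g h) (vertex g h')) →
                  productCol _ _ e ≡ a ↑ʳ col cH h h' eH
  column-colour {g} {h} {h'} eH e with adj G (π₁ (vertex g h)) (π₁ (vertex g h')) Bool.≟ true
  ... | yes eG'
    with () ← trans (sym (adj-irrefl G g)) (subst₂ (Adj G) (π₁-vertex g h) (π₁-vertex g h') eG')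
  ... | no _ = cong (a ↑ʳ_) (colour-cong cH (π₂-vertex g h) (π₂-vertex g h') _ eH)

  row : Vertex H → ColourEmbedding cG productColouring
  row h = record
    { vmap = λ g → vertex g h ; vmap-injective = combine-injectiveˡ _ h _ h ; adj-preserved = row-adj
    ; cmap = _↑ˡ b ; cmap-injective = ↑ˡ-injective b _ _ ; col-preserved = row-colour }

  column : Vertex G → ColourEmbedding cH productColouring
  column g = record
    { vmap = vertex g ; vmap-injective = combine-injectiveʳ g _ g _ ; adj-preserved = column-adj
    ; cmap = a ↑ʳ_ ; cmap-injective = ↑ʳ-injective a _ _ ; col-preserved = column-colour }

  module Assembly (o : Vertex G) (T : RainbowTree cH) where

    -- A leg: a tree of G to be copied into the row of the given vertex of H.
    Leg : Set
    Leg = Vertex H × RainbowTree cG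

    columnTree : RainbowTree productColouring
    columnTree = image (column o) T

    legTree : Leg → RainbowTree productColouring
    legTree (h , A) = image (row h) A

    record Spider (L : List Leg) : Set where
      field
        body          : RainbowTree productColouring
        column⊆       : verts columnTree ⊆ verts body
        legs⊆         : All (λ ℓ → verts (legTree ℓ) ⊆ verts body) L
        vertsFrom     : ∀ {p} → p ∈ verts body →
                        p ∈ verts columnTree ⊎ Any (λ ℓ → p ∈ verts (legTree ℓ)) L
        coloursFrom   : ∀ {k} → k ∈ colours productColouring (edges body) →
                        k ∈ map (a ↑ʳ_) (colours cH (edges T)) ⊎
                        Any (λ ℓ → k ∈ map (_↑ˡ b) (colours cG (edges (proj₂ ℓ)))) L
    open Spider public

    column-spider : Spider []
    column-spider = record
      { body = columnTree ; column⊆ = id ; legs⊆ = []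
      ; vertsFrom = inj₁ ; coloursFrom = inj₁ ∘ subst (_ ∈_) (image-colours (column o) T) }

    add-leg : ∀ {L} → Spider L → (h : Vertex H) (A : RainbowTree cG) → h ∈ verts T → o ∈ verts A →
              All (λ ℓ → Separated o A (proj₂ ℓ)) L → Spider ((h , A) ∷ L)
    add-leg {L} S h A h∈T o∈A seps = record
      { body = union glued
      ; column⊆ = ⊇left glued ∘ column⊆ S
      ; legs⊆ = ⊇right glued ∷ All.map (λ ℓ⊆ {p} p∈ → ⊇left glued (ℓ⊆ p∈)) (legs⊆ S)
      ; vertsFrom = [ Sum.map₂ there ∘ vertsFrom S , inj₂ ∘ here ]
                    ∘ ∈-++⁻ (verts (body S)) ∘ vertsUnion glued
      ; coloursFrom = [ Sum.map₂ there ∘ coloursFrom S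
                      , inj₂ ∘ here ∘ subst (_ ∈_) (image-colours (row h) A) ]
                      ∘ ∈-++⁻ (colours productColouring (edges (body S))) ∘ coloursUnion glued }
      where
      -- The new leg meets the body only in (o, h): in the column, and in an old leg
      -- (whose tree is separated from A at o), only vertices with first coordinate o.
      leg-meets : ∀ {w} → w ∈ verts A → ∀ {ℓ : Leg} → Separated o A (proj₂ ℓ) →
                  vertex w h ∈ verts (legTree ℓ) → w ≡ o
      leg-meets w∈A {h' , A'} (separated meet _) p∈ with ∈-map⁻ _ p∈
      ... | w' , w'∈A' , eq =
        meet w∈A (subst (_∈ verts A') (sym (combine-injectiveˡ _ h w' h' eq)) w'∈A')

      in-body : ∀ {w} → w ∈ verts A → vertex w h ∈ verts (body S) → w ≡ o
      in-body w∈A p∈ with vertsFrom S p∈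
      ... | inj₁ p∈col = let _ , _ , eq = ∈-map⁻ _ p∈col in combine-injectiveˡ _ h o _ eq
      ... | inj₂ p∈legs = lookupWith {R = λ _ → _ ≡ o} (leg-meets w∈A) seps p∈legs

      meet : ∀ {p} → p ∈ verts (legTree (h , A)) → p ∈ verts (body S) → p ≡ vertex o h
      meet p∈ p∈body with ∈-map⁻ _ p∈
      ... | w , w∈A , refl = cong (λ g → vertex g h) (in-body w∈A p∈body)

      -- The new leg brings new colours: column colours lie in the H-half of Fin (a + b),
      -- and the colours of an old leg are disjoint from those of A.
      leg-clash : ∀ {i} → i ∈ colours cG (edges A) → ∀ {ℓ : Leg} → Separated o A (proj₂ ℓ) →
                  i ↑ˡ b ∈ map (_↑ˡ b) (colours cG (edges (proj₂ ℓ))) → ⊥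
      leg-clash i∈A {ℓ} (separated _ disj) i∈ with ∈-map⁻ _ i∈
      ... | j , j∈A' , eq =
        disj (i∈A , subst (_∈ colours cG (edges (proj₂ ℓ))) (sym (↑ˡ-injective b _ _ eq)) j∈A')

      disj : Disjoint (colours productColouring (edges (body S)))
                      (colours productColouring (edges (legTree (h , A))))
      disj (k∈body , k∈leg) with ∈-map⁻ _ (subst (_ ∈_) (image-colours (row h) A) k∈leg)
      ... | i , i∈A , refl with coloursFrom S k∈body
      ...   | inj₁ k∈col = let j , _ , eq = ∈-map⁻ _ k∈col in ↑ˡ≢↑ʳ i j eq
      ...   | inj₂ k∈legs = lookupWith {R = λ _ → ⊥} (λ {ℓ} → leg-clash i∈A {ℓ}) seps k∈legs

      glued : Glued (body S) (verts (legTree (h , A))) (edges (legTree (h , A)))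
      glued = glue (body S) (isTree (legTree (h , A))) (rainbow (legTree (h , A)))
                   (column⊆ S (∈-map⁺ (vertex o) h∈T)) (∈-map⁺ (λ g → vertex g h) o∈A) meet disj

  open Assembly

  tripod-product : ∀ {W E g₁ g₂ g₃ h₁ h₂ h₃} → Tripod {c = cG} W E g₁ g₂ g₃ →
                   (T : RainbowTree cH) → h₁ ∈ verts T → h₂ ∈ verts T → h₃ ∈ verts T →
                   Σ (RainbowTree productColouring) λ Y →
                     vertex g₁ h₁ ∈ verts Y × vertex g₂ h₂ ∈ verts Y × vertex g₃ h₃ ∈ verts Y
  tripod-product {h₁ = h₁} {h₂} {h₃} Tp T h₁∈ h₂∈ h₃∈ =
    body spider , leg⊆ (there (there (here refl))) (on-leg (arm₁ Tp))
                , leg⊆ (there (here refl)) (on-leg (arm₂ Tp))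
                , leg⊆ (here refl) (on-leg (arm₃ Tp))
    where
    on-leg : ∀ {x y h} (A : Arm _ _ x y) → vertex y h ∈ map (λ g → vertex g h) (verts (arm A))
    on-leg A = ∈-map⁺ _ (target∈arm A)
    legs : List (Leg (centre Tp) T)
    legs = (h₃ , arm (arm₃ Tp)) ∷ (h₂ , arm (arm₂ Tp)) ∷ (h₁ , arm (arm₁ Tp)) ∷ []
    spider : Spider (centre Tp) T legs
    spider =
      add-leg _ _ (add-leg _ _ (add-leg _ _ (column-spider _ _)
        h₁ (arm (arm₁ Tp)) h₁∈ (centre∈arm (arm₁ Tp)) [])
        h₂ (arm (arm₂ Tp)) h₂∈ (centre∈arm (arm₂ Tp)) (separated-sym (sep₁₂ Tp) ∷ []))
        h₃ (arm (arm₃ Tp)) h₃∈ (centre∈arm (arm₃ Tp))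
        (separated-sym (sep₂₃ Tp) ∷ separated-sym (sep₁₃ Tp) ∷ [])
    leg⊆ : ∀ {ℓ} → ℓ ∈ legs → verts (legTree (centre Tp) T ℓ) ⊆ verts (body spider)
    leg⊆ = All.lookup (legs⊆ spider)

  product-3-rainbow : 3 ≤ order G → 3 ≤ order H → Is3Rainbow cG → Is3Rainbow cH →
                      Is3Rainbow productColouring
  product-3-rainbow bigG bigH rbG rbH p q r _ _ _
    with rainbow-cover {c = cG} bigG rbG (π₁ p) (π₁ q) (π₁ r)
       | rainbow-cover {c = cH} bigH rbH (π₂ p) (π₂ q) (π₂ r)
  ... | TG , g₁∈ , g₂∈ , g₃∈ | TH , h₁∈ , h₂∈ , h₃∈
    with tripod-product (tripod (isTree TG) (rainbow TG) g₁∈ g₂∈ g₃∈) TH h₁∈ h₂∈ h₃∈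
  ... | Y , p∈ , q∈ , r∈ =
    verts Y , edges Y , isTree Y , rainbow Y , coords p p∈ , coords q q∈ , coords r r∈
    where
    coords : ∀ s → vertex (π₁ s) (π₂ s) ∈ verts Y → s ∈ verts Y
    coords s = subst (_∈ verts Y) (combine-remQuot {n G} (n H) s)

⊠-3-rainbow : ∀ {G H a b} → 3 ≤ order G → 3 ≤ order H →
              Has3RainbowColoring G a → Has3RainbowColoring H b → Has3RainbowColoring (G ⊠ H) (a + b)
⊠-3-rainbow {G} {H} bigG bigH (cG , rbG) (cH , rbH) =
  productColouring , product-3-rainbow bigG bigH rbG rbH
  where open Product G H cG cH

⊠ⁿ-order : ∀ k (Gs : Fin (suc k) → Graph) → (∀ i → 3 ≤ order (Gs i)) → 3 ≤ order (⊠ⁿ (suc k) Gs)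
⊠ⁿ-order 0 Gs big = big zero
⊠ⁿ-order (suc k) Gs big =
  *-mono-≤ (big zero) (≤-trans (s≤s z≤n) (⊠ⁿ-order k (Gs ∘ suc) (big ∘ suc)))

⊠ⁿ-3-rainbow : ∀ k (Gs : Fin (suc k) → Graph) (r : Fin (suc k) → ℕ) → (∀ i → 3 ≤ order (Gs i)) →
               (∀ i → Has3RainbowColoring (Gs i) (r i)) →
               Has3RainbowColoring (⊠ⁿ (suc k) Gs) (∑ (suc k) r)
⊠ⁿ-3-rainbow 0 Gs r big has = subst (Has3RainbowColoring (Gs zero)) (sym (+-identityʳ (r zero))) (has zero)
⊠ⁿ-3-rainbow (suc k) Gs r big has =
  ⊠-3-rainbow (big zero) (⊠ⁿ-order k (Gs ∘ suc) (big ∘ suc))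
              (has zero) (⊠ⁿ-3-rainbow k (Gs ∘ suc) (r ∘ suc) (big ∘ suc) (has ∘ suc))

corollary2 : (k : ℕ) → 2 ≤ k → (Gs : Fin k → Graph) →
             (∀ i → Connected (Gs i)) → (∀ i → 3 ≤ order (Gs i)) →
             (r : Fin k → ℕ) → (∀ i → Rx3 (Gs i) (r i)) →
             (R : ℕ) → Rx3 (⊠ⁿ k Gs) R →
             R ≤ ∑ k r
corollary2 (suc (suc k)) _ Gs _ big r rx R (_ , minimal) =
  ≮⇒≥ λ sum<R → minimal (∑ (suc (suc k)) r) sum<R (⊠ⁿ-3-rainbow (suc k) Gs r big (proj₁ ∘ rx))
corollary2 1 (s≤s ()) _ _ _ _ _ _ _
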